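{- Let $G=(V_B\cup V_R,E)$ be a bipartite graph with blue vertices $V_B$ and red vertices $V_R$ such that no blue vertex $b$ satisfies $N(b)\subseteq N(b')$ for another blue vertex $b'$, and no red vertex $r$ satisfies $N(r)\supseteq N(r')$ for another red vertex $r'$. Let $v\in V_B$. Then $P(v)\neq\emptyset$ if and only if there is a red vertex $r\in V_R$ with $N(v)=P(v)=\{r\}$ and $N(r)=\{v\}$.
   Context: $N(v)=\{u:\{u,v\}\in E\}$ and $N(S)=\bigcup_{s\in S}N(s)$. For a blue vertex $b$, its private neighborhood is $P(b)=\{r\in N(b): N(N(r))\subseteq N(b)\}$. -}

module Defs where

open import Data.Nat using (ℕ)
open import Data.Fin using (Fin)
open import Data.Product using (∃; _×_)
open import Relation.Binary.PropositionalEquality using (_≡_)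
open import Relation.Nullary using (¬_)
open import Relation.Unary using (Pred; _⊆_; _∈_)
open import Level using (0ℓ)

-- A finite bipartite graph: blue vertices Fin nB, red vertices Fin nR,
-- edge relation E b r meaning {b, r} ∈ E.
BipGraph : ℕ → ℕ → Set₁
BipGraph nB nR = Fin nB → Fin nR → Set

Nb : ∀ {nB nR} → BipGraph nB nR → Fin nB → Pred (Fin nR) 0ℓ
Nb E b r = E b r

Nr : ∀ {nB nR} → BipGraph nB nR → Fin nR → Pred (Fin nB) 0ℓ
Nr E r b = E b r

NbSet : ∀ {nB nR} → BipGraph nB nR → Pred (Fin nB) 0ℓ → Pred (Fin nR) 0ℓ
NbSet E S r = ∃ λ b → b ∈ S × E b r

Priv : ∀ {nB nR} → BipGraph nB nR → Fin nB → Pred (Fin nR) 0ℓ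
Priv E b r = r ∈ Nb E b × (NbSet E (Nr E r) ⊆ Nb E b)

BlueReduced : ∀ {nB nR} → BipGraph nB nR → Set
BlueReduced E = ∀ b b' → ¬ (b ≡ b') → ¬ (Nb E b ⊆ Nb E b')

RedReduced : ∀ {nB nR} → BipGraph nB nR → Set
RedReduced E = ∀ r r' → ¬ (r ≡ r') → ¬ (Nr E r' ⊆ Nr E r)

-- A private neighbour r of v forces N(b) ⊆ N(v) for every b ∈ N(r), so
-- blue-reducedness gives N(r) = {v}. Then N(r) ⊆ N(r') for every
-- r' ∈ N(v), and red-reducedness gives N(v) = {r}; since P(v) ⊆ N(v)
-- contains r, also P(v) = {r}.
module Submission where

open import Defs
open import Data.Nat using (ℕ)
open import Data.Fin using (Fin; _≟_)
open import Data.Product using (Σ; _×_; _,_; proj₁)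
open import Function using (_∘_)
open import Function.Bundles using (_⇔_; mk⇔)
open import Relation.Unary using (Pred; Satisfiable; _≐_; _⊆_; ｛_｝; _∈_)
open import Relation.Nullary.Decidable using (decidable-stable)
open import Relation.Binary.PropositionalEquality using (_≡_; refl; ≢-sym; subst)

≐-｛｝ : ∀ {a ℓ} {A : Set a} {P : Pred A ℓ} {x : A} →
         x ∈ P → P ⊆ ｛ x ｝ → P ≐ ｛ x ｝
≐-｛｝ x∈P P⊆｛x｝ = P⊆｛x｝ , λ { refl → x∈P }

module _ {nB nR : ℕ} (E : BipGraph nB nR) where

  Priv⇒Nr⊆｛v｝ : BlueReduced E → ∀ {v r} → r ∈ Priv E v → Nr E r ⊆ ｛ v ｝
  Priv⇒Nr⊆｛v｝ blueReduced {v} (_ , N[N[r]]⊆N[v]) {b} ebr =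
    decidable-stable (v ≟ b) λ v≢b →
      blueReduced b v (≢-sym v≢b) (λ ebx → N[N[r]]⊆N[v] (b , ebr , ebx))

  Nr⊆｛v｝⇒Nb⊆｛r｝ : RedReduced E → ∀ {v r} → Nr E r ⊆ ｛ v ｝ → Nb E v ⊆ ｛ r ｝
  Nr⊆｛v｝⇒Nb⊆｛r｝ redReduced {r = r} N[r]⊆｛v｝ {r'} evr' =
    decidable-stable (r ≟ r') λ r≢r' →
      redReduced r' r (≢-sym r≢r')
        (λ ebr → subst (λ b → E b r') (N[r]⊆｛v｝ ebr) evr')

fact1 : (nB nR : ℕ) (E : BipGraph nB nR) → BlueReduced E → RedReduced E →
    (v : Fin nB) →
    Satisfiable (Priv E v) ⇔
    Σ (Fin nR) (λ r → (Nb E v ≐ ｛ r ｝) × (Priv E v ≐ ｛ r ｝) × (Nr E r ≐ ｛ v ｝))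
fact1 nB nR E blueReduced redReduced v = mk⇔ to from
  where
  to : Satisfiable (Priv E v) →
       Σ (Fin nR) (λ r → (Nb E v ≐ ｛ r ｝) × (Priv E v ≐ ｛ r ｝) × (Nr E r ≐ ｛ v ｝))
  to (r , r∈P@(evr , _)) =
    r , ≐-｛｝ evr N[v]⊆｛r｝ , ≐-｛｝ r∈P (N[v]⊆｛r｝ ∘ proj₁) , ≐-｛｝ evr N[r]⊆｛v｝
    where
    N[r]⊆｛v｝ : Nr E r ⊆ ｛ v ｝
    N[r]⊆｛v｝ = Priv⇒Nr⊆｛v｝ E blueReduced r∈P
    N[v]⊆｛r｝ : Nb E v ⊆ ｛ r ｝
    N[v]⊆｛r｝ = Nr⊆｛v｝⇒Nb⊆｛r｝ E redReduced N[r]⊆｛v｝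

  from : Σ (Fin nR) (λ r → (Nb E v ≐ ｛ r ｝) × (Priv E v ≐ ｛ r ｝) × (Nr E r ≐ ｛ v ｝)) →
         Satisfiable (Priv E v)
  from (r , _ , (_ , ｛r｝⊆P) , _) = r , ｛r｝⊆P refl
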